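{- Let $\Sigma$ be a set and $R\subseteq\Sigma\times\Sigma$ any relation. Then $R=R_{\langle P_R,\tau_R,Q_R\rangle}$.
   Context: Notation. - For a relation $R$: $R(x)=\{y\mid (x,y)\in R\}$ and $R(S)=\bigcup_{x\in S}R(x)$. - For a partition $P$, $P(x)$ is the block containing $x$. 2PR triples. - A 2PR triple is $\langle P,\tau,Q\rangle$ with $P,Q$ partitions of $\Sigma$ and $\tau:P\to\wp(Q)$. - It encodes the relation $R_{\langle P,\tau,Q\rangle}$ with $R_{\langle P,\tau,Q\rangle}(x)=\bigcup\tau(P(x))$. The 2PR triple induced by a relation $R$ is $\langle P_R,\tau_R,Q_R\rangle$, where: - $P_R=\{\{y\mid R(y)=R(x)\}\mid x\in\Sigma\}$; - $Q_R=\{\{y\mid R^{ -1}(y)=R^{ -1}(x)\}\mid x\in\Sigma\}$; - $\tau_R(B)=\{C\in Q_R\mid C\subseteq R(B)\}$. -}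

module Defs where

open import Level using (Level; _⊔_)
open import Data.Product using (Σ; ∃; _×_; _,_)
open import Function.Bundles using (_⇔_)
open import Relation.Binary.Core using (REL; Rel)

_≐_ : ∀ {a ℓ} {A : Set a} → (A → Set ℓ) → (A → Set ℓ) → Set (a ⊔ ℓ)
S ≐ T = ∀ z → S z ⇔ T z

_⊆_ : ∀ {a ℓ m} {A : Set a} → (A → Set ℓ) → (A → Set m) → Set (a ⊔ ℓ ⊔ m)
S ⊆ T = ∀ z → S z → T z

image : ∀ {a ℓ m} {A : Set a} → Rel A ℓ → (A → Set m) → A → Set (a ⊔ ℓ ⊔ m)
image R S z = ∃ λ y → S y × R y z

_⁻¹ : ∀ {a ℓ} {A : Set a} → Rel A ℓ → Rel A ℓ
(R ⁻¹) x y = R y x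

-- Partitions are given by their block
-- relation: P x y means y ∈ P(x) (the block of x).  Blocks are referred
-- to through representatives, so τ x w means  Q(w) ∈ τ(P(x)).
record TwoPR {a} (A : Set a) (ℓ : Level) : Set (a ⊔ Level.suc ℓ) where
  field
    P : Rel A ℓ
    τ : Rel A ℓ
    Q : Rel A ℓ

-- R_⟨P,τ,Q⟩(x) = ⋃ τ(P(x)) = { z | ∃ block C ∈ τ(P(x)), z ∈ C }.
relOf : ∀ {a ℓ} {A : Set a} → TwoPR A ℓ → Rel A (a ⊔ ℓ)
relOf T x z = ∃ λ w → τ x w × Q w z
  where open TwoPR T

induced : ∀ {a ℓ} {A : Set a} → Rel A ℓ → TwoPR A (a ⊔ ℓ)
induced {A = A} R = record
  { P = λ x y → R y ≐ R x
  ; Q = λ x y → (R ⁻¹) y ≐ (R ⁻¹) x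
  ; τ = λ x w → (λ y → (R ⁻¹) y ≐ (R ⁻¹) w) ⊆ image R (λ y → R y ≐ R x)
  }

_≐ᵣ_ : ∀ {a ℓ m} {A : Set a} → Rel A ℓ → Rel A m → Set (a ⊔ ℓ ⊔ m)
R ≐ᵣ S = ∀ x y → R x y ⇔ S x y

-- R(x) is the union of the Q_R-blocks it meets, since R(x) is a union of
-- columns: z ∈ R(x) depends only on R⁻¹(z).  Moreover R is constant on each
-- P_R-block, so R(P_R(x)) = R(x) and τ_R(P_R(x)) consists exactly of the
-- Q_R-blocks inside R(x).
module Submission where

open import Defs
open import Relation.Binary.Core using (Rel)
open import Data.Product using (_,_)
open import Function.Bundles using (_⇔_; mk⇔; Equivalence)
open import Function.Construct.Identity using (⇔-id)
open import Function.Construct.Symmetry using (⇔-sym)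

open Equivalence using (to; from)

≐-refl : ∀ {a ℓ} {A : Set a} {S : A → Set ℓ} → S ≐ S
≐-refl {S = S} z = ⇔-id (S z)

module _ {a ℓ} {A : Set a} (R : Rel A ℓ) where
  open TwoPR (induced R)

  image-P-block : ∀ x z → image R (P x) z ⇔ R x z
  image-P-block x z = mk⇔
    (λ { (u , Ru≐Rx , Ruz) → to (Ru≐Rx z) Ruz })
    (λ Rxz → x , ≐-refl , Rxz)

  τ-induced⇔ : ∀ x w → τ x w ⇔ R x w
  τ-induced⇔ x w = mk⇔
    (λ Qw⊆RPx → to (image-P-block x w) (Qw⊆RPx w ≐-refl))
    (λ Rxw v Qwv → from (image-P-block x v) (from (Qwv x) Rxw))

  relOf-induced⇔ : ∀ x y → relOf (induced R) x y ⇔ R x y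
  relOf-induced⇔ x y = mk⇔
    (λ { (w , τxw , Qwy) → from (Qwy x) (to (τ-induced⇔ x w) τxw) })
    (λ Rxy → y , from (τ-induced⇔ x y) Rxy , ≐-refl)

mainTheorem9 : ∀ {a ℓ} {A : Set a} (R : Rel A ℓ) → R ≐ᵣ relOf (induced R)
mainTheorem9 R x y = ⇔-sym (relOf-induced⇔ R x y)
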